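{- Let $D$ be an $\overrightarrow{S_{3,1}}$-free oriented graph and $v\in V(D)$. If $d^-(N^-(v))\rhd(3,3,3)$, then, listing the in-degrees of the vertices of $N^-(v)$ in decreasing order, $$d^-(N^-(v))=(3,3,3,1,0,0,\ldots,0)\quad\text{or}\quad d^-(N^-(v))=(3,3,3,0,0,\ldots,0).$$
   Context: An oriented graph is a digraph obtained from a finite simple undirected graph by orienting each edge. $N^-(v)$ is the set of in-neighbors of $v$, $d^-(u)$ the in-degree of $u$ in $D$, and $d^-(N^-(v))$ the vector of in-degrees $d^-(u)$ for $u\in N^-(v)$. For nonnegative vectors $\mathbf{x}\in\mathbb{R}^s$, $\mathbf{y}\in\mathbb{R}^t$, write $x_{[1]}\ge\cdots\ge x_{[s]}$ for the entries of $\mathbf x$ in decreasing order; $\mathbf{x}\rhd\mathbf{y}$ means $s\geq t$ and $x_{[i]}\geq y_{[i]}$ for all $1\le i\le t$. $\overrightarrow{S_{3,1}}$ is the digraph with vertices $c,w_1,w_2,w_3,z_1,z_2,z_3$ and arcs $z_iw_i$, $w_ic$ ($i=1,2,3$); $D$ is $\overrightarrow{S_{3,1}}$-free if it has no subgraph isomorphic to it. -}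

module Defs where

open import Data.Nat using (ℕ; _≤_)
open import Data.Nat.Properties using (≤-decTotalOrder)
open import Data.Bool using (Bool; true; false)
open import Data.Fin using (Fin; zero; suc)
open import Data.List using (List; length; map; filterᵇ; take)
open import Data.List.Relation.Binary.Pointwise using (Pointwise)
open import Data.Product using (_×_; ∃)
open import Relation.Binary.PropositionalEquality using (_≡_)
open import Relation.Nullary using (¬_)
open import Function.Definitions using (Injective)
import Relation.Binary.Construct.Flip.EqAndOrd as Flip
import Data.List.Sort as Sort
import Data.List.Base as LB

-- A digraph on vertex set Fin n, given by its arc indicator:
-- arc u v ≡ true  iff  uv is an arc (from u to v).
Digraph : ℕ → Set
Digraph n = Fin n → Fin n → Bool

Oriented : ∀ {n} → Digraph n → Set
Oriented {n} D = (∀ (u : Fin n) → D u u ≡ false)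
               × (∀ (u v : Fin n) → D u v ≡ true → D v u ≡ false)

inNbrs : ∀ {n} → Digraph n → Fin n → List (Fin n)
inNbrs {n} D v = filterᵇ (λ u → D u v) (LB.allFin n)

indeg : ∀ {n} → Digraph n → Fin n → ℕ
indeg D v = length (inNbrs D v)

sortDesc : List ℕ → List ℕ
sortDesc = Sort.sort (Flip.decTotalOrder ≤-decTotalOrder)

inDegSeq : ∀ {n} → Digraph n → Fin n → List ℕ
inDegSeq D v = sortDesc (map (indeg D) (inNbrs D v))

_▷_ : List ℕ → List ℕ → Set
x ▷ y = (length y ≤ length x)
      × Pointwise (λ a b → b ≤ a) (take (length y) (sortDesc x)) (sortDesc y)

-- Vertices of S_{3,1}: 0 = c, 1,2,3 = w_1,w_2,w_3, 4,5,6 = z_1,z_2,z_3.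
-- A copy of S_{3,1} in D: an injective vertex map preserving the arcs z_i w_i, w_i c.
S31-copy : ∀ {n} → Digraph n → (Fin 7 → Fin n) → Set
S31-copy D f =
    (D (f z1) (f w1) ≡ true) × (D (f w1) (f c0) ≡ true)
  × (D (f z2) (f w2) ≡ true) × (D (f w2) (f c0) ≡ true)
  × (D (f z3) (f w3) ≡ true) × (D (f w3) (f c0) ≡ true)
  where
    c0 w1 w2 w3 z1 z2 z3 : Fin 7
    c0 = zero
    w1 = suc zero
    w2 = suc (suc zero)
    w3 = suc (suc (suc zero))
    z1 = suc (suc (suc (suc zero)))          
    z2 = suc (suc (suc (suc (suc zero))))
    z3 = suc (suc (suc (suc (suc (suc zero)))))

S31-free : ∀ {n} → Digraph n → Set
S31-free {n} D = ¬ ∃ λ (f : Fin 7 → Fin n) → Injective _≡_ _≡_ f × S31-copy D f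

{-# OPTIONS --safe #-}
-- Call an in-neighbour of v high if its in-degree is at least 3.  A copy of S_{3,1}
-- centred at v is nothing but three in-neighbours of v together with one further
-- in-neighbour ("leg") of each, all six vertices distinct; legs are chosen greedily.
-- Greedy legs show that three high in-neighbours a, b, c of v must form a directed
-- triangle a → b → c → a, and then that any two in-neighbours x, y of a outside the
-- triangle are in-neighbours of b and c as well, with N⁻(a) = {c, x, y},
-- N⁻(b) = {a, x, y} and N⁻(c) = {b, x, y}.  Using these arcs as legs, every other
-- in-neighbour u of v can receive an arc only from x or y, and only when u is the
-- other one of the two; so apart from 3, 3, 3 the sequence has at most one entry 1
-- and otherwise zeros, which is read off from its numbers of entries ≥ 1, ≥ 2, ≥ 3.
module Submission where

open import Defs
open import Data.Nat using (ℕ; suc; _≤_; _<_; _≥_; _≤?_; _≤ᵇ_; z≤n; s≤s)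
open import Data.Nat.Properties
  using (≤-decTotalOrder; ≤-trans; ≤-refl; ≤-antisym; <⇒≤; <⇒≱; ≰⇒>; <-irrefl; n≤0⇒n≡0; +-cancelˡ-≤)
open import Data.Bool using (true; false)
open import Data.Bool.Properties using (T-≡) renaming (_≟_ to _≟ᵇ_)
open import Data.Empty using (⊥; ⊥-elim)
open import Data.Fin using (Fin)
open import Data.Fin.Properties using (_≟_)
open import Data.List using (List; []; _∷_; _++_; length; map; filter; take; replicate; allFin)
open import Data.List.Membership.Propositional using (_∈_; _∉_; find; lose)
open import Data.List.Membership.Propositional.Properties using (∈-∃++; ∈-filter⁻)
open import Data.List.Properties using (filter-accept; filter-some)
open import Data.List.Relation.Binary.Permutation.Propositional using (_↭_; ↭-sym)
open import Data.List.Relation.Binary.Permutation.Propositional.Properties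
  using (∈-resp-↭; ↭-length; shift; filter-↭; All-resp-↭)
open import Data.List.Relation.Binary.Pointwise using (Pointwise; []; _∷_; Pointwise-≡⇒≡)
open import Data.List.Relation.Binary.Subset.Propositional using (_⊆_)
open import Data.List.Relation.Unary.All as All using (All; []; _∷_)
open import Data.List.Relation.Unary.All.Properties using (¬Any⇒All¬; All¬⇒¬Any; map⁺)
open import Data.List.Relation.Unary.Any using (here; there; any?)
open import Data.List.Relation.Unary.Linked as Linked using (Linked; [-]; _∷_)
open import Data.List.Relation.Unary.Linked.Properties using (Linked⇒All)
open import Data.List.Relation.Unary.Sorted.TotalOrder.Properties using (↗↭↗⇒≋)
open import Data.List.Relation.Unary.Unique.Propositional using (Unique; []; _∷_)
import Data.List.Relation.Unary.Unique.Propositional.Properties as Unique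
import Data.List.Sort as Sort
open import Data.Product using (∃; ∃-syntax; _×_; _,_; proj₁; proj₂; map₁; map₂)
open import Data.Sum using (_⊎_; inj₁; inj₂; [_,_]′) renaming (map to ⊎-map)
open import Data.Vec using (Vec; lookup; []; _∷_)
open import Data.Vec.Relation.Unary.Unique.Propositional using () renaming (Unique to Uniqueᵛ)
open import Data.Vec.Relation.Unary.All using () renaming (All to Allᵛ)
open import Data.Vec.Relation.Unary.All using ([]; _∷_)
open import Data.Vec.Relation.Unary.AllPairs using ([]; _∷_)
open import Data.Vec.Relation.Unary.Unique.Propositional.Properties using (lookup-injective)
open import Function using (_∘_; Equivalence)
open import Relation.Binary using (DecTotalOrder)
open import Relation.Binary.Definitions using (DecidableEquality)
import Relation.Binary.Construct.Flip.EqAndOrd as Flip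
open import Relation.Binary.PropositionalEquality using (_≡_; _≢_; refl; sym; trans; cong; subst; subst₂; ≢-sym)
open import Relation.Nullary using (¬_; Dec; yes; no; ¬?)
open import Relation.Nullary.Decidable using (decidable-stable; T?)

module _ {a} {A : Set a} where

  ∈⇒↭∷ : ∀ {x : A} {xs} → x ∈ xs → ∃[ ys ] xs ↭ x ∷ ys
  ∈⇒↭∷ x∈xs with ys , zs , refl ← ∈-∃++ x∈xs = ys ++ zs , shift _ ys zs

  ⊆-∷⁻ : ∀ {x : A} {xs ys} → x ∉ xs → xs ⊆ x ∷ ys → xs ⊆ ys
  ⊆-∷⁻ x∉xs xs⊆x∷ys z∈xs with xs⊆x∷ys z∈xs
  ... | here refl = ⊥-elim (x∉xs z∈xs)
  ... | there z∈ys = z∈ys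

  Unique-⊆⇒length-≤ : ∀ {xs ys : List A} → Unique xs → xs ⊆ ys → length xs ≤ length ys
  Unique-⊆⇒length-≤ [] _ = z≤n
  Unique-⊆⇒length-≤ {x ∷ xs} {ys} (x≢xs ∷ xs!) x∷xs⊆ys with ys′ , ys↭ ← ∈⇒↭∷ (x∷xs⊆ys (here refl)) =
    subst (suc (length xs) ≤_) (sym (↭-length ys↭)) (s≤s (Unique-⊆⇒length-≤ xs! xs⊆ys′))
    where
    xs⊆ys′ : xs ⊆ ys′
    xs⊆ys′ = ⊆-∷⁻ (All¬⇒¬Any x≢xs) (λ z∈xs → ∈-resp-↭ ys↭ (x∷xs⊆ys (there z∈xs)))

module _ {a} {A : Set a} (_≟_ : DecidableEquality A) where
  open import Data.List.Membership.DecPropositional _≟_ using (_∈?_)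

  ∈-by-exclusion : ∀ {x : A} {xs} → (All (_≢ x) xs → ⊥) → x ∈ xs
  ∈-by-exclusion {x} {xs} x≢xs⇒⊥ =
    decidable-stable (x ∈? xs) (x≢xs⇒⊥ ∘ All.map ≢-sym ∘ ¬Any⇒All¬ xs)

  ∃-∉ : ∀ {xs ys : List A} → Unique xs → length ys < length xs → ∃[ x ] x ∈ xs × x ∉ ys
  ∃-∉ {xs} {ys} xs! |ys|<|xs| with any? (λ x → ¬? (x ∈? ys)) xs
  ... | yes x∉ys = find x∉ys
  ... | no ¬x∉ys = ⊥-elim (<⇒≱ |ys|<|xs| (Unique-⊆⇒length-≤ xs! xs⊆ys))
    where
    xs⊆ys : xs ⊆ ys
    xs⊆ys {x} x∈xs = decidable-stable (x ∈? ys) (¬x∉ys ∘ lose x∈xs)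

count≥ : ℕ → List ℕ → ℕ
count≥ k = length ∘ filter (k ≤?_)

count≥-∷-≥ : ∀ {k x} xs → k ≤ x → count≥ k (x ∷ xs) ≡ suc (count≥ k xs)
count≥-∷-≥ {k} xs k≤x = cong length (filter-accept (k ≤?_) {xs = xs} k≤x)

count≥-↭ : ∀ k {xs ys} → xs ↭ ys → count≥ k xs ≡ count≥ k ys
count≥-↭ k xs↭ys = ↭-length (filter-↭ (k ≤?_) xs↭ys)

count≥-map : ∀ {a} {A : Set a} k (f : A → ℕ) xs → count≥ k (map f xs) ≡ length (filter (λ x → k ≤? f x) xs)
count≥-map k f [] = refl
count≥-map k f (x ∷ xs) with k ≤ᵇ f x
... | true = cong suc (count≥-map k f xs)
... | false = count≥-map k f xs

count≥≡0⇒All< : ∀ {k} xs → count≥ k xs ≡ 0 → All (_< k) xs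
count≥≡0⇒All< {k} xs #≡0 =
  All.map ≰⇒> (¬Any⇒All¬ xs (λ some → <-irrefl refl (subst (0 <_) #≡0 (filter-some (k ≤?_) some))))

count≥-prefix : ∀ {k} xs ys → Pointwise _≥_ (take (length ys) xs) ys → All (k ≤_) ys → length ys ≤ count≥ k xs
count≥-prefix _ [] _ _ = z≤n
count≥-prefix (x ∷ xs) (y ∷ ys) (x≥y ∷ p) (k≤y ∷ k≤ys) =
  subst (suc (length ys) ≤_) (sym (count≥-∷-≥ xs (≤-trans k≤y x≥y))) (s≤s (count≥-prefix xs ys p k≤ys))

≥-decTotalOrder : DecTotalOrder _ _ _
≥-decTotalOrder = Flip.decTotalOrder ≤-decTotalOrder

module SortDesc = Sort.SortingAlgorithm ≥-decTotalOrder (Sort.sortingAlgorithm ≥-decTotalOrder)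

-- Unfolded, this is Sorted for the order used by sortDesc, so SortDesc.sort-↗ proves it.
Descending : List ℕ → Set
Descending = Linked _≥_

descending⇒sortDesc-≡ : ∀ {xs} → Descending xs → sortDesc xs ≡ xs
descending⇒sortDesc-≡ {xs} xs↓ =
  Pointwise-≡⇒≡ (↗↭↗⇒≋ (DecTotalOrder.totalOrder ≥-decTotalOrder) (SortDesc.sort-↗ xs) xs↓ (SortDesc.sort-↭ₛ xs))

▷⇒take-≥ : ∀ {xs ys} → Descending xs → Descending ys → xs ▷ ys → Pointwise _≥_ (take (length ys) xs) ys
▷⇒take-≥ {xs} {ys} xs↓ ys↓ (_ , p) =
  subst₂ (λ as bs → Pointwise _≥_ (take (length ys) as) bs)
         (descending⇒sortDesc-≡ xs↓) (descending⇒sortDesc-≡ ys↓) p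

All≤0⇒replicate : ∀ {xs} → All (_≤ 0) xs → xs ≡ replicate (length xs) 0
All≤0⇒replicate [] = refl
All≤0⇒replicate (z≤n ∷ ps) = cong (0 ∷_) (All≤0⇒replicate ps)

descending-01-shape : ∀ {xs} → Descending xs → All (_< 2) xs → count≥ 1 xs ≤ 1
  → (∃ λ m → xs ≡ 1 ∷ replicate m 0) ⊎ (∃ λ m → xs ≡ replicate m 0)
descending-01-shape {[]} _ _ _ = inj₂ (0 , refl)
descending-01-shape {0 ∷ xs} xs↓ _ _ =
  inj₂ (_ , All≤0⇒replicate (Linked⇒All (λ y≥x z≥y → ≤-trans z≥y y≥x) ≤-refl xs↓))
descending-01-shape {1 ∷ xs} _ _ #≥1≤1 =
  inj₁ (_ , cong (1 ∷_) (All≤0⇒replicate (All.map (λ { (s≤s x≤0) → x≤0 })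
                         (count≥≡0⇒All< xs (n≤0⇒n≡0 (+-cancelˡ-≤ 1 _ _ #≥1≤1))))))
descending-01-shape {suc (suc _) ∷ _} _ (s≤s (s≤s ()) ∷ _) _

descending-333-shape : ∀ {xs} → Descending xs → Pointwise _≥_ (take 3 xs) (3 ∷ 3 ∷ 3 ∷ [])
  → All (_≤ 3) xs → count≥ 2 xs ≤ 3 → count≥ 1 xs ≤ 4
  → (∃ λ m → xs ≡ 3 ∷ 3 ∷ 3 ∷ 1 ∷ replicate m 0) ⊎ (∃ λ m → xs ≡ 3 ∷ 3 ∷ 3 ∷ replicate m 0)
descending-333-shape {x₁ ∷ x₂ ∷ x₃ ∷ xs} (_ ∷ _ ∷ x₃∷xs↓)
  (x₁≥3 ∷ x₂≥3 ∷ x₃≥3 ∷ []) (x₁≤3 ∷ x₂≤3 ∷ x₃≤3 ∷ _) #≥2≤3 #≥1≤4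
  with refl ← ≤-antisym x₁≤3 x₁≥3 | refl ← ≤-antisym x₂≤3 x₂≥3 | refl ← ≤-antisym x₃≤3 x₃≥3 =
  ⊎-map (map₂ (cong (λ ys → 3 ∷ 3 ∷ 3 ∷ ys))) (map₂ (cong (λ ys → 3 ∷ 3 ∷ 3 ∷ ys)))
        (descending-01-shape (Linked.tail x₃∷xs↓)
                           (count≥≡0⇒All< xs (n≤0⇒n≡0 (+-cancelˡ-≤ 3 _ _ #≥2≤3)))
                           (+-cancelˡ-≤ 3 _ _ #≥1≤4))

module Arcs {n} (D : Digraph n) where

  infix 4 _⟶_

  _⟶_ : Fin n → Fin n → Set
  u ⟶ w = D u w ≡ true

  _⟶?_ : ∀ u w → Dec (u ⟶ w)
  u ⟶? w = D u w ≟ᵇ true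

  ∈-inNbrs⁻ : ∀ {u w} → u ∈ inNbrs D w → u ⟶ w
  ∈-inNbrs⁻ {u} {w} u∈ = Equivalence.to T-≡ (proj₂ (∈-filter⁻ (λ z → T? (D z w)) {xs = allFin n} u∈))

  inNbrs-unique : ∀ w → Unique (inNbrs D w)
  inNbrs-unique w = Unique.filter⁺ (λ z → T? (D z w)) (Unique.allFin⁺ n)

  indeg-≤ : ∀ {u} S → (∀ {z} → z ⟶ u → z ∈ S) → indeg D u ≤ length S
  indeg-≤ {u} S ⟶u⇒∈S = Unique-⊆⇒length-≤ (inNbrs-unique u) (⟶u⇒∈S ∘ ∈-inNbrs⁻)

  ∃-inNbr-avoiding : ∀ {u} S → length S < indeg D u → ∃[ z ] z ⟶ u × All (_≢ z) S
  ∃-inNbr-avoiding {u} S |S|<d with z , z∈ , z∉S ← ∃-∉ _≟_ (inNbrs-unique u) |S|<d =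
    z , ∈-inNbrs⁻ z∈ , All.map ≢-sym (¬Any⇒All¬ S z∉S)

  tight-bound⇒⟶ : ∀ {u S s} → (∀ {z} → z ⟶ u → z ∈ S) → length S ≤ indeg D u → s ∈ S → s ⟶ u
  tight-bound⇒⟶ {u} {S} {s} ⟶u⇒∈S |S|≤d s∈S with s ⟶? u
  ... | yes s⟶u = s⟶u
  ... | no s↛u with S′ , S↭ ← ∈⇒↭∷ s∈S =
    ⊥-elim (<⇒≱ (subst (_≤ indeg D u) (↭-length S↭) |S|≤d) d≤|S′|)
    where
    d≤|S′| : indeg D u ≤ length S′
    d≤|S′| = Unique-⊆⇒length-≤ (inNbrs-unique u)
               (⊆-∷⁻ (s↛u ∘ ∈-inNbrs⁻) (λ z∈ → ∈-resp-↭ S↭ (⟶u⇒∈S (∈-inNbrs⁻ z∈))))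

  ¬⟶⇒≢ : ∀ {x z w} → ¬ x ⟶ w → z ⟶ w → x ≢ z
  ¬⟶⇒≢ x↛w z⟶w refl = x↛w z⟶w

module OrientedArcs {n} {D : Digraph n} (oriented : Oriented D) where

  open Arcs D

  ⟶⇒≢ : ∀ {u w} → u ⟶ w → u ≢ w
  ⟶⇒≢ {u} u⟶u refl with () ← trans (sym (proj₁ oriented u)) u⟶u

  ⟵⇒≢ : ∀ {u w} → u ⟶ w → w ≢ u
  ⟵⇒≢ = ≢-sym ∘ ⟶⇒≢

  ⟶-asym : ∀ {u w} → u ⟶ w → ¬ w ⟶ u
  ⟶-asym {u} {w} u⟶w w⟶u with () ← trans (sym (proj₂ oriented u w u⟶w)) w⟶u

  path-end≢start : ∀ {x y z} → x ⟶ y → y ⟶ z → z ≢ x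
  path-end≢start x⟶y y⟶x refl = ⟶-asym x⟶y y⟶x

module InNeighbourhood {n} {D : Digraph n} (oriented : Oriented D) (free : S31-free D) (v : Fin n) where

  open Arcs D
  open OrientedArcs oriented

  no-three-legs : ∀ {w₁ w₂ w₃ z₁ z₂ z₃} → w₁ ⟶ v → w₂ ⟶ v → w₃ ⟶ v → z₁ ⟶ w₁ → z₂ ⟶ w₂ → z₃ ⟶ w₃
    → Uniqueᵛ (w₁ ∷ w₂ ∷ w₃ ∷ z₁ ∷ z₂ ∷ z₃ ∷ []) → ⊥
  no-three-legs {w₁} {w₂} {w₃} {z₁} {z₂} {z₃} w₁⟶v w₂⟶v w₃⟶v z₁⟶w₁ z₂⟶w₂ z₃⟶w₃ distinct =
    free (lookup vertices , lookup-injective (v-fresh ∷ distinct) _ _ , z₁⟶w₁ , w₁⟶v , z₂⟶w₂ , w₂⟶v , z₃⟶w₃ , w₃⟶v)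
    where
    vertices : Vec (Fin n) 7
    vertices = v ∷ w₁ ∷ w₂ ∷ w₃ ∷ z₁ ∷ z₂ ∷ z₃ ∷ []
    v-fresh : Allᵛ (v ≢_) (w₁ ∷ w₂ ∷ w₃ ∷ z₁ ∷ z₂ ∷ z₃ ∷ [])
    v-fresh = ⟵⇒≢ w₁⟶v ∷ ⟵⇒≢ w₂⟶v ∷ ⟵⇒≢ w₃⟶v
            ∷ path-end≢start z₁⟶w₁ w₁⟶v ∷ path-end≢start z₂⟶w₂ w₂⟶v
            ∷ path-end≢start z₃⟶w₃ w₃⟶v ∷ []

  High : Fin n → Set
  High w = w ⟶ v × 3 ≤ indeg D w

  no-forward-arcs : ∀ {a b c} → High a → High b → High c → a ≢ b → a ≢ c → b ≢ c
    → ¬ a ⟶ b → ¬ a ⟶ c → ¬ b ⟶ c → ⊥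
  no-forward-arcs {a} {b} {c} (a⟶v , a-deg) (b⟶v , b-deg) (c⟶v , c-deg) a≢b a≢c b≢c a↛b a↛c b↛c
    with za , za⟶a , b≢za ∷ c≢za ∷ [] ← ∃-inNbr-avoiding (b ∷ c ∷ []) a-deg
    with zb , zb⟶b , c≢zb ∷ za≢zb ∷ [] ← ∃-inNbr-avoiding (c ∷ za ∷ []) b-deg
    with zc , zc⟶c , za≢zc ∷ zb≢zc ∷ [] ← ∃-inNbr-avoiding (za ∷ zb ∷ []) c-deg =
    no-three-legs a⟶v b⟶v c⟶v za⟶a zb⟶b zc⟶c
      ( (a≢b ∷ a≢c ∷ ⟵⇒≢ za⟶a ∷ ¬⟶⇒≢ a↛b zb⟶b ∷ ¬⟶⇒≢ a↛c zc⟶c ∷ [])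
      ∷ (b≢c ∷ b≢za ∷ ⟵⇒≢ zb⟶b ∷ ¬⟶⇒≢ b↛c zc⟶c ∷ [])
      ∷ (c≢za ∷ c≢zb ∷ ⟵⇒≢ zc⟶c ∷ [])
      ∷ (za≢zb ∷ za≢zc ∷ [])
      ∷ (zb≢zc ∷ [])
      ∷ [] ∷ [])

  forced-arc : ∀ {a b c} → High a → High b → High c → a ≢ b → a ≢ c → b ≢ c → ¬ a ⟶ c → b ⟶ c
  forced-arc {a} {b} {c} ha hb hc a≢b a≢c b≢c a↛c with b ⟶? c | a ⟶? b
  ... | yes b⟶c | _ = b⟶c
  ... | no b↛c | no a↛b = ⊥-elim (no-forward-arcs ha hb hc a≢b a≢c b≢c a↛b a↛c b↛c)
  ... | no b↛c | yes a⟶b = ⊥-elim (no-forward-arcs hb ha hc (≢-sym a≢b) b≢c a≢c (⟶-asym a⟶b) b↛c a↛c)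

  record CyclicTriangle : Set where
    constructor triangle
    field
      {a b c} : Fin n
      a-high : High a
      b-high : High b
      c-high : High c
      a⟶b : a ⟶ b
      b⟶c : b ⟶ c
      c⟶a : c ⟶ a

  rotate : CyclicTriangle → CyclicTriangle
  rotate (triangle ha hb hc a⟶b b⟶c c⟶a) = triangle hb hc ha b⟶c c⟶a a⟶b

  cyclic-triangle : ∀ {w₁ w₂ w₃} → High w₁ → High w₂ → High w₃ → w₁ ≢ w₂ → w₁ ≢ w₃ → w₂ ≢ w₃ → CyclicTriangle
  cyclic-triangle {w₁} {w₂} {w₃} h₁ h₂ h₃ w₁≢w₂ w₁≢w₃ w₂≢w₃ with w₂ ⟶? w₁
  ... | yes w₂⟶w₁ = triangle h₁ h₃ h₂ w₁⟶w₃ w₃⟶w₂ w₂⟶w₁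
    where
    w₃⟶w₂ : w₃ ⟶ w₂
    w₃⟶w₂ = forced-arc h₁ h₃ h₂ w₁≢w₃ w₁≢w₂ (≢-sym w₂≢w₃) (⟶-asym w₂⟶w₁)
    w₁⟶w₃ : w₁ ⟶ w₃
    w₁⟶w₃ = forced-arc h₂ h₁ h₃ (≢-sym w₁≢w₂) w₂≢w₃ w₁≢w₃ (⟶-asym w₃⟶w₂)
  ... | no w₂↛w₁ = triangle h₁ h₂ h₃ w₁⟶w₂ w₂⟶w₃ w₃⟶w₁
    where
    w₃⟶w₁ : w₃ ⟶ w₁
    w₃⟶w₁ = forced-arc h₂ h₃ h₁ w₂≢w₃ (≢-sym w₁≢w₂) (≢-sym w₁≢w₃) w₂↛w₁
    w₂⟶w₃ : w₂ ⟶ w₃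
    w₂⟶w₃ = forced-arc h₁ h₂ h₃ w₁≢w₂ w₁≢w₃ w₂≢w₃ (⟶-asym w₃⟶w₁)
    w₁⟶w₂ : w₁ ⟶ w₂
    w₁⟶w₂ = forced-arc h₃ h₁ h₂ (≢-sym w₁≢w₃) (≢-sym w₂≢w₃) w₁≢w₂ (⟶-asym w₂⟶w₃)

  cyclic-triangle-in : ∀ ws → Unique ws → 3 ≤ length ws → (∀ {w} → w ∈ ws → High w) → CyclicTriangle
  cyclic-triangle-in (w₁ ∷ w₂ ∷ w₃ ∷ _) ((w₁≢w₂ ∷ w₁≢w₃ ∷ _) ∷ (w₂≢w₃ ∷ _) ∷ _) _ high =
    cyclic-triangle (high (here refl)) (high (there (here refl))) (high (there (there (here refl))))
                    w₁≢w₂ w₁≢w₃ w₂≢w₃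
  cyclic-triangle-in [] _ () _
  cyclic-triangle-in (_ ∷ []) _ (s≤s ()) _
  cyclic-triangle-in (_ ∷ _ ∷ []) _ (s≤s (s≤s ())) _

  -- Otherwise a fourth in-neighbour z of b, an in-neighbour zc ∉ {b, z} of c and
  -- one of x, y other than zc would be legs at b, c and a.
  inNbrs-of-successor : (T : CyclicTriangle) → let open CyclicTriangle T in
    ∀ {x y z} → x ⟶ a → y ⟶ a → x ≢ y → c ≢ x → c ≢ y → z ⟶ b → z ∈ a ∷ x ∷ y ∷ []
  inNbrs-of-successor T {x} {y} {z} x⟶a y⟶a x≢y c≢x c≢y z⟶b = ∈-by-exclusion _≟_ fourth-inNbr
    where
    open CyclicTriangle T
    fourth-inNbr : All (_≢ z) (a ∷ x ∷ y ∷ []) → ⊥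
    fourth-inNbr (a≢z ∷ x≢z ∷ y≢z ∷ [])
      with zc , zc⟶c , b≢zc ∷ z≢zc ∷ [] ← ∃-inNbr-avoiding (b ∷ z ∷ []) (proj₂ c-high)
      with zc ≟ x
    ... | yes refl =
      no-three-legs (proj₁ a-high) (proj₁ b-high) (proj₁ c-high) y⟶a z⟶b zc⟶c
        ( (⟶⇒≢ a⟶b ∷ ⟵⇒≢ c⟶a ∷ ⟵⇒≢ y⟶a ∷ a≢z ∷ ⟵⇒≢ x⟶a ∷ [])
        ∷ (⟶⇒≢ b⟶c ∷ path-end≢start y⟶a a⟶b ∷ ⟵⇒≢ z⟶b ∷ b≢zc ∷ [])
        ∷ (c≢y ∷ path-end≢start z⟶b b⟶c ∷ c≢x ∷ [])
        ∷ (y≢z ∷ ≢-sym x≢y ∷ [])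
        ∷ (z≢zc ∷ [])
        ∷ [] ∷ [])
    ... | no zc≢x =
      no-three-legs (proj₁ a-high) (proj₁ b-high) (proj₁ c-high) x⟶a z⟶b zc⟶c
        ( (⟶⇒≢ a⟶b ∷ ⟵⇒≢ c⟶a ∷ ⟵⇒≢ x⟶a ∷ a≢z ∷ path-end≢start zc⟶c c⟶a ∷ [])
        ∷ (⟶⇒≢ b⟶c ∷ path-end≢start x⟶a a⟶b ∷ ⟵⇒≢ z⟶b ∷ b≢zc ∷ [])
        ∷ (c≢x ∷ path-end≢start z⟶b b⟶c ∷ ⟵⇒≢ zc⟶c ∷ [])
        ∷ (x≢z ∷ ≢-sym zc≢x ∷ [])
        ∷ (z≢zc ∷ [])
        ∷ [] ∷ [])

  record DominatedTriangle : Set where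
    field
      cyclic : CyclicTriangle
    open CyclicTriangle cyclic public
    field
      {x y} : Fin n
      x≢y : x ≢ y
      x⟶a : x ⟶ a
      x⟶b : x ⟶ b
      x⟶c : x ⟶ c
      y⟶a : y ⟶ a
      y⟶b : y ⟶ b
      y⟶c : y ⟶ c

  module _ (T : CyclicTriangle) where
    open CyclicTriangle T

    dominate : DominatedTriangle
    dominate
      with x , x⟶a , c≢x ∷ [] ← ∃-inNbr-avoiding (c ∷ []) (<⇒≤ (proj₂ a-high))
      with y , y⟶a , c≢y ∷ x≢y ∷ [] ← ∃-inNbr-avoiding (c ∷ x ∷ []) (proj₂ a-high) =
      record { cyclic = T ; x≢y = x≢y
             ; x⟶a = x⟶a ; x⟶b = x⟶b ; x⟶c = x⟶c
             ; y⟶a = y⟶a ; y⟶b = y⟶b ; y⟶c = y⟶c }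
      where
      b-inNbrs : ∀ {z} → z ⟶ b → z ∈ a ∷ x ∷ y ∷ []
      b-inNbrs = inNbrs-of-successor T x⟶a y⟶a x≢y c≢x c≢y
      x⟶b : x ⟶ b
      x⟶b = tight-bound⇒⟶ b-inNbrs (proj₂ b-high) (there (here refl))
      y⟶b : y ⟶ b
      y⟶b = tight-bound⇒⟶ b-inNbrs (proj₂ b-high) (there (there (here refl)))
      c-inNbrs : ∀ {z} → z ⟶ c → z ∈ b ∷ x ∷ y ∷ []
      c-inNbrs = inNbrs-of-successor (rotate T) x⟶b y⟶b x≢y (⟵⇒≢ x⟶a) (⟵⇒≢ y⟶a)
      x⟶c : x ⟶ c
      x⟶c = tight-bound⇒⟶ c-inNbrs (proj₂ c-high) (there (here refl))
      y⟶c : y ⟶ c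
      y⟶c = tight-bound⇒⟶ c-inNbrs (proj₂ c-high) (there (there (here refl)))

  rotateᴰ : DominatedTriangle → DominatedTriangle
  rotateᴰ C = record { cyclic = rotate cyclic ; x≢y = x≢y
                     ; x⟶a = x⟶b ; x⟶b = x⟶c ; x⟶c = x⟶a
                     ; y⟶a = y⟶b ; y⟶b = y⟶c ; y⟶c = y⟶a }
    where open DominatedTriangle C

  no-outer-inNbr : (T : CyclicTriangle) → let open CyclicTriangle T in
    ∀ {q u z} → q ⟶ a → q ⟶ b → q ⟶ c → u ⟶ v → z ⟶ u
    → All (_≢ u) (a ∷ b ∷ c ∷ []) → All (_≢ z) (a ∷ b ∷ c ∷ []) → q ≢ u → q ≢ z → ⊥
  no-outer-inNbr T q⟶a q⟶b q⟶c u⟶v z⟶u (a≢u ∷ b≢u ∷ c≢u ∷ []) (a≢z ∷ b≢z ∷ c≢z ∷ []) q≢u q≢z =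
    no-three-legs (proj₁ a-high) (proj₁ b-high) u⟶v c⟶a q⟶b z⟶u
      ( (⟶⇒≢ a⟶b ∷ a≢u ∷ ⟵⇒≢ c⟶a ∷ ⟵⇒≢ q⟶a ∷ a≢z ∷ [])
      ∷ (b≢u ∷ ⟶⇒≢ b⟶c ∷ ⟵⇒≢ q⟶b ∷ b≢z ∷ [])
      ∷ (≢-sym c≢u ∷ ≢-sym q≢u ∷ ⟵⇒≢ z⟶u ∷ [])
      ∷ (⟵⇒≢ q⟶c ∷ c≢z ∷ [])
      ∷ (q≢z ∷ [])
      ∷ [] ∷ [])
    where open CyclicTriangle T

  module _ (C : DominatedTriangle) where
    open DominatedTriangle C

    no-arc-from-corner : ∀ {u} → u ⟶ v → b ≢ u → c ≢ u → ¬ a ⟶ u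
    no-arc-from-corner u⟶v b≢u c≢u a⟶u =
      no-three-legs (proj₁ b-high) (proj₁ c-high) u⟶v x⟶b y⟶c a⟶u
        ( (⟶⇒≢ b⟶c ∷ b≢u ∷ ⟵⇒≢ x⟶b ∷ ⟵⇒≢ y⟶b ∷ ⟵⇒≢ a⟶b ∷ [])
        ∷ (c≢u ∷ ⟵⇒≢ x⟶c ∷ ⟵⇒≢ y⟶c ∷ ⟶⇒≢ c⟶a ∷ [])
        ∷ (path-end≢start x⟶a a⟶u ∷ path-end≢start y⟶a a⟶u ∷ ⟵⇒≢ a⟶u ∷ [])
        ∷ (x≢y ∷ ⟶⇒≢ x⟶a ∷ [])
        ∷ (⟶⇒≢ y⟶a ∷ [])
        ∷ [] ∷ [])

    corner-indeg≤3 : indeg D a ≤ 3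
    corner-indeg≤3 = indeg-≤ (c ∷ x ∷ y ∷ [])
      (inNbrs-of-successor (rotate (rotate cyclic)) x⟶c y⟶c x≢y (⟵⇒≢ x⟶b) (⟵⇒≢ y⟶b))

  module _ (C : DominatedTriangle) where
    open DominatedTriangle C

    twin-arc : ∀ {u z} → u ⟶ v → All (_≢ u) (a ∷ b ∷ c ∷ []) → z ⟶ u → (u ≡ x × z ≡ y) ⊎ (u ≡ y × z ≡ x)
    twin-arc {u} {z} u⟶v u∉@(a≢u ∷ b≢u ∷ c≢u ∷ []) z⟶u with a ≟ z | b ≟ z | c ≟ z
    ... | yes refl | _ | _ = ⊥-elim (no-arc-from-corner C u⟶v b≢u c≢u z⟶u)
    ... | _ | yes refl | _ = ⊥-elim (no-arc-from-corner (rotateᴰ C) u⟶v c≢u a≢u z⟶u)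
    ... | _ | _ | yes refl = ⊥-elim (no-arc-from-corner (rotateᴰ (rotateᴰ C)) u⟶v a≢u b≢u z⟶u)
    ... | no a≢z | no b≢z | no c≢z with x ≟ u | y ≟ u | x ≟ z | y ≟ z
    ...   | yes refl | _ | _ | yes refl = inj₁ (refl , refl)
    ...   | yes refl | _ | _ | no y≢z =
      ⊥-elim (no-outer-inNbr cyclic y⟶a y⟶b y⟶c u⟶v z⟶u u∉ (a≢z ∷ b≢z ∷ c≢z ∷ []) (≢-sym x≢y) y≢z)
    ...   | no _ | yes refl | yes refl | _ = inj₂ (refl , refl)
    ...   | no _ | yes refl | no x≢z | _ =
      ⊥-elim (no-outer-inNbr cyclic x⟶a x⟶b x⟶c u⟶v z⟶u u∉ (a≢z ∷ b≢z ∷ c≢z ∷ []) x≢y x≢z)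
    ...   | no _ | no y≢u | yes refl | _ =
      ⊥-elim (no-outer-inNbr cyclic y⟶a y⟶b y⟶c u⟶v z⟶u u∉ (a≢z ∷ b≢z ∷ c≢z ∷ []) y≢u (≢-sym x≢y))
    ...   | no x≢u | no _ | no x≢z | _ =
      ⊥-elim (no-outer-inNbr cyclic x⟶a x⟶b x⟶c u⟶v z⟶u u∉ (a≢z ∷ b≢z ∷ c≢z ∷ []) x≢u x≢z)

    outer-indeg≤1 : ∀ {u} → u ⟶ v → All (_≢ u) (a ∷ b ∷ c ∷ []) → indeg D u ≤ 1
    outer-indeg≤1 {u} u⟶v u∉ with x ≟ u
    ... | yes refl = indeg-≤ (y ∷ []) λ z⟶u → [ here ∘ proj₂ , ⊥-elim ∘ x≢y ∘ proj₁ ]′ (twin-arc u⟶v u∉ z⟶u)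
    ... | no x≢u = indeg-≤ (x ∷ []) λ z⟶u → [ ⊥-elim ∘ x≢u ∘ sym ∘ proj₁ , here ∘ proj₂ ]′ (twin-arc u⟶v u∉ z⟶u)

    outer-receiver : ∃[ s ] ∀ {u z} → u ⟶ v → All (_≢ u) (a ∷ b ∷ c ∷ []) → z ⟶ u → u ≡ s
    outer-receiver with y ⟶? x
    ... | yes y⟶x = x , λ u⟶v u∉ z⟶u →
      [ proj₁ , (λ (u≡y , z≡x) → ⊥-elim (⟶-asym (subst₂ _⟶_ z≡x u≡y z⟶u) y⟶x)) ]′ (twin-arc u⟶v u∉ z⟶u)
    ... | no y↛x = y , λ u⟶v u∉ z⟶u →
      [ (λ (u≡x , z≡y) → ⊥-elim (y↛x (subst₂ _⟶_ z≡y u≡x z⟶u))) , proj₁ ]′ (twin-arc u⟶v u∉ z⟶u)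

    inNbr-indeg≤3 : ∀ {u} → u ⟶ v → indeg D u ≤ 3
    inNbr-indeg≤3 {u} u⟶v with a ≟ u | b ≟ u | c ≟ u
    ... | yes refl | _ | _ = corner-indeg≤3 C
    ... | _ | yes refl | _ = corner-indeg≤3 (rotateᴰ C)
    ... | _ | _ | yes refl = corner-indeg≤3 (rotateᴰ (rotateᴰ C))
    ... | no a≢u | no b≢u | no c≢u = ≤-trans (outer-indeg≤1 u⟶v (a≢u ∷ b≢u ∷ c≢u ∷ [])) (s≤s z≤n)

  inNbrs≥ : ℕ → List (Fin n)
  inNbrs≥ k = filter (λ u → k ≤? indeg D u) (inNbrs D v)

  ∈-inNbrs≥⁻ : ∀ {k u} → u ∈ inNbrs≥ k → u ⟶ v × k ≤ indeg D u
  ∈-inNbrs≥⁻ {k} u∈ = map₁ ∈-inNbrs⁻ (∈-filter⁻ (λ u → k ≤? indeg D u) u∈)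

  inNbrs≥-unique : ∀ k → Unique (inNbrs≥ k)
  inNbrs≥-unique k = Unique.filter⁺ (λ u → k ≤? indeg D u) (inNbrs-unique v)

  count≥-inDegSeq : ∀ k → count≥ k (inDegSeq D v) ≡ length (inNbrs≥ k)
  count≥-inDegSeq k = trans (count≥-↭ k (SortDesc.sort-↭ _)) (count≥-map k (indeg D) (inNbrs D v))

  dominated-triangle : 3 ≤ count≥ 3 (inDegSeq D v) → DominatedTriangle
  dominated-triangle #≥3 = dominate
    (cyclic-triangle-in (inNbrs≥ 3) (inNbrs≥-unique 3) (subst (3 ≤_) (count≥-inDegSeq 3) #≥3) ∈-inNbrs≥⁻)

  module _ (C : DominatedTriangle) where
    open DominatedTriangle C

    inDegSeq-≤3 : All (_≤ 3) (inDegSeq D v)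
    inDegSeq-≤3 = All-resp-↭ (↭-sym (SortDesc.sort-↭ _)) (map⁺ (All.tabulate (inNbr-indeg≤3 C ∘ ∈-inNbrs⁻)))

    count≥2-inDegSeq : count≥ 2 (inDegSeq D v) ≤ 3
    count≥2-inDegSeq = subst (_≤ 3) (sym (count≥-inDegSeq 2))
      (Unique-⊆⇒length-≤ (inNbrs≥-unique 2) λ u∈ → let u⟶v , 2≤d = ∈-inNbrs≥⁻ u∈ in
        ∈-by-exclusion _≟_ (λ u∉ → <⇒≱ 2≤d (outer-indeg≤1 C u⟶v u∉)))

    count≥1-inDegSeq : count≥ 1 (inDegSeq D v) ≤ 4
    count≥1-inDegSeq = subst (_≤ 4) (sym (count≥-inDegSeq 1))
      (Unique-⊆⇒length-≤ (inNbrs≥-unique 1) inNbrs≥1⊆)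
      where
      s : Fin n
      s = proj₁ (outer-receiver C)
      inNbrs≥1⊆ : inNbrs≥ 1 ⊆ a ∷ b ∷ c ∷ s ∷ []
      inNbrs≥1⊆ u∈ with u⟶v , 1≤d ← ∈-inNbrs≥⁻ u∈ with z , z⟶u , [] ← ∃-inNbr-avoiding [] 1≤d =
        ∈-by-exclusion _≟_ λ { (a≢u ∷ b≢u ∷ c≢u ∷ s≢u ∷ []) →
          s≢u (sym (proj₂ (outer-receiver C) u⟶v (a≢u ∷ b≢u ∷ c≢u ∷ []) z⟶u)) }

lemma2p5 : ∀ {n} (D : Digraph n) → Oriented D → S31-free D → (v : Fin n)
    → inDegSeq D v ▷ (3 ∷ 3 ∷ 3 ∷ [])
    → (∃ λ m → inDegSeq D v ≡ 3 ∷ 3 ∷ 3 ∷ 1 ∷ replicate m 0)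
      ⊎ (∃ λ m → inDegSeq D v ≡ 3 ∷ 3 ∷ 3 ∷ replicate m 0)
lemma2p5 D oriented free v ▷333 =
  descending-333-shape inDegSeq↓ top (inDegSeq-≤3 C) (count≥2-inDegSeq C) (count≥1-inDegSeq C)
  where
  open InNeighbourhood oriented free v
  inDegSeq↓ : Descending (inDegSeq D v)
  inDegSeq↓ = SortDesc.sort-↗ _
  top : Pointwise _≥_ (take 3 (inDegSeq D v)) (3 ∷ 3 ∷ 3 ∷ [])
  top = ▷⇒take-≥ inDegSeq↓ (≤-refl ∷ ≤-refl ∷ [-]) ▷333
  C : DominatedTriangle
  C = dominated-triangle (count≥-prefix _ (3 ∷ 3 ∷ 3 ∷ []) top (≤-refl ∷ ≤-refl ∷ ≤-refl ∷ []))
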